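{- Let $(G,Z)$ be a plantation, let $F=G\setminus Z$, and let $N$ be the set of vertices in $V(G)\setminus Z$ with a neighbour in $Z$. Suppose that every component of $F$ contains at least two vertices of $N$. Then there is a normal set $\mathcal{S}$ of transitions with $|\mathcal{S}|\ge |N|/4$.
   Context: Fix an integer $s\ge1$. Graphs are finite and simple. Two subgraphs are anticomplete if their vertex sets are disjoint with no edges between them. A graph is $s\mathcal{O}$-free if no $s$ cycles of it are pairwise vertex-disjoint and pairwise anticomplete. $Z\subseteq V(G)$ is cycle-hitting if every cycle of $G$ meets $Z$. A plantation is a pair $(G,Z)$ with $G$ an $s\mathcal{O}$-free graph and $Z\subseteq V(G)$ cycle-hitting (so $F$ is a forest). A transition is a path of $F$ with at least one edge, both ends in $N$, and no internal vertex in $N$. A set $\mathcal{S}$ of transitions is normal if (a) for all $P,Q\in\mathcal{S}$, either $P,Q$ are anticomplete or $P,Q$ have a common end, and (b) each $P\in\mathcal{S}$ has an edge belonging to no other member of $\mathcal{S}$. -}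

module Defs where

open import Data.Nat using (ℕ; _≤_; _*_)
open import Data.Bool using (Bool; true; false; not; _∧_)
open import Data.Fin using (Fin)
open import Data.Fin.Subset as Sub using (Subset; ∣_∣)
open import Data.List using (List; []; _∷_; _++_; [_]; length; take; reverse; map; allFin)
open import Data.Bool.ListAction using (any)
open import Data.List.Relation.Unary.All using (All)
open import Data.List.Relation.Unary.Linked using (Linked)
open import Data.List.Relation.Unary.Unique.Propositional using (Unique)
open import Data.List.Membership.Propositional as L using ()
open import Data.Vec using (lookup; tabulate)
open import Data.Product using (Σ; ∃; ∃-syntax; _×_; _,_)
open import Data.Sum using (_⊎_)
open import Relation.Nullary using (¬_)
open import Relation.Binary.PropositionalEquality using (_≡_; _≢_)

record Graph (n : ℕ) : Set where
  field
    adj    : Fin n → Fin n → Bool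
    sym    : ∀ u v → adj u v ≡ adj v u
    irrefl : ∀ v → adj v v ≡ false
open Graph public

module _ {n : ℕ} (G : Graph n) where

  Edge : Fin n → Fin n → Set
  Edge u v = adj G u v ≡ true

  record Cycle : Set where
    field
      cverts : List (Fin n)
      clen   : 3 ≤ length cverts
      cuniq  : Unique cverts
      cclosed : Linked Edge (cverts ++ take 1 cverts)
  open Cycle public

  Anticomplete : List (Fin n) → List (Fin n) → Set
  Anticomplete A B = ∀ {a b} → a L.∈ A → b L.∈ B → (a ≢ b) × ¬ Edge a b

  SOFree : ℕ → Set
  SOFree s = ¬ (Σ (Fin s → Cycle) λ C →
                 ∀ i j → i ≢ j → Anticomplete (cverts (C i)) (cverts (C j)))

  module _ (Z : Subset n) where

    CycleHitting : Set
    CycleHitting = ∀ (C : Cycle) → ∃[ v ] (v L.∈ cverts C × v Sub.∈ Z)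

    hasZNbr : Fin n → Bool
    hasZNbr v = any (λ u → lookup Z u ∧ adj G v u) (allFin n)

    Nset : Subset n
    Nset = tabulate (λ v → not (lookup Z v) ∧ hasZNbr v)

    data ReachF : Fin n → Fin n → Set where
      here : ∀ {v} → v Sub.∉ Z → ReachF v v
      step : ∀ {u w v} → u Sub.∉ Z → Edge u w → ReachF w v → ReachF u v

    ComponentsTwoN : Set
    ComponentsTwoN = ∀ v → v Sub.∉ Z →
      ∃[ u ] ∃[ w ] (u ≢ w × u Sub.∈ Nset × w Sub.∈ Nset × ReachF v u × ReachF v w)

    record Transition : Set where
      field
        start : Fin n
        mid   : List (Fin n)
        end   : Fin n
      tverts : List (Fin n)
      tverts = start ∷ mid ++ [ end ]
      field
        tuniq   : Unique tverts
        tpath   : Linked Edge tverts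
        tinF    : All (Sub._∉ Z) tverts
        startN  : start Sub.∈ Nset
        endN    : end Sub.∈ Nset
        midNotN : All (Sub._∉ Nset) mid
    open Transition public

data Consec {A : Set} (x y : A) : List A → Set where
  now   : ∀ {zs} → Consec x y (x ∷ y ∷ zs)
  later : ∀ {z zs} → Consec x y zs → Consec x y (z ∷ zs)

module _ {n : ℕ} {G : Graph n} {Z : Subset n} where

  PathEdge : Transition G Z → Fin n → Fin n → Set
  PathEdge P x y = Consec x y (tverts P) ⊎ Consec y x (tverts P)

  SameSubgraph : Transition G Z → Transition G Z → Set
  SameSubgraph P Q = tverts P ≡ tverts Q ⊎ tverts P ≡ reverse (tverts Q)

  CommonEnd : Transition G Z → Transition G Z → Set
  CommonEnd P Q = (start P ≡ start Q ⊎ start P ≡ end Q) ⊎ (end P ≡ start Q ⊎ end P ≡ end Q)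

  -- A family of k pairwise distinct transitions (a set of size k)
  Distinct : {k : ℕ} → (Fin k → Transition G Z) → Set
  Distinct S = ∀ i j → i ≢ j → ¬ SameSubgraph (S i) (S j)

  Normal : {k : ℕ} → (Fin k → Transition G Z) → Set
  Normal {k} S =
    (∀ i j → Anticomplete G (tverts (S i)) (tverts (S j)) ⊎ CommonEnd (S i) (S j))
    × (∀ i → ∃[ x ] ∃[ y ] (PathEdge (S i) x y × (∀ j → j ≢ i → ¬ PathEdge (S j) x y)))

{-# OPTIONS --safe #-}
module Submission where

-- Pick one vertex of N in each component of F as its root and take breadth-first layers
-- from the roots.  Because Z meets every cycle, F is a forest, so every edge of F joins
-- a vertex to its parent.  Let the level of a vertex be the number of vertices of N on
-- its path to the root.  For each non-root vertex v of N, the path from v up to the next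
-- vertex of N is a transition whose vertices have level that of v or one less.  Two such
-- transitions starting at the same level share an end or are anticomplete, and two whose
-- starting levels differ by at least three are anticomplete; so the transitions starting
-- at levels in one residue class modulo 3 form a normal set, each owning its first edge.
-- Every component has a second vertex of N, hence a vertex of N at level 2, so there are no
-- more roots than vertices of N at level 2, and the largest class has at least |N|/4 members.

open import Data.Bool using (Bool; true; false; not; _∧_; _∨_; if_then_else_)
open import Data.Bool.ListAction using (any)
open import Data.Bool.Properties using (T-≡) renaming (_≟_ to _≟ᵇ_)
open import Data.Empty using (⊥; ⊥-elim)
open import Data.Fin using (Fin; zero; suc; toℕ; #_)
open import Data.Fin.Properties using (all?; ¬∀⟶∃¬; injective⇒≤)
  renaming (_≟_ to _≟ᶠ_; suc-injective to fsuc-injective)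
open import Data.Fin.Subset as Sub using (Subset; ∣_∣; inside; outside)
open import Data.List using (List; []; _∷_; _++_; [_]; allFin; length; last; applyUpTo; applyDownFrom)
open import Data.List.Membership.Propositional using (_∈_)
open import Data.List.Membership.Propositional.Properties
  using (∈-allFin; ∈-applyUpTo⁻; ∈-applyDownFrom⁻; ∈-++⁻)
open import Data.List.Properties
  using (∷-injectiveˡ; reverse-++; applyUpTo-∷ʳ; ++-assoc; length-++; length-applyUpTo; length-applyDownFrom)
import Data.List.Relation.Unary.All as All
open import Data.List.Relation.Unary.Any using (here; there)
open import Data.List.Relation.Unary.Linked using (Linked; [-])
import Data.List.Relation.Unary.Linked.Properties as Linkedₚ
open import Data.List.Relation.Unary.Unique.Propositional using (Unique)
import Data.List.Relation.Unary.Unique.Propositional.Properties as Uniqueₚ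
open import Data.Maybe using (Maybe; just; nothing; maybe; fromMaybe)
import Data.Maybe as Maybe
open import Data.Maybe.Properties using (just-injective)
open import Data.Maybe.Relation.Binary.Connected using (Connected; just)
open import Data.Nat
open import Data.Nat.Properties
open import Data.Product using (Σ; ∃-syntax; _×_; _,_; proj₁; proj₂)
open import Data.Sum using (_⊎_; inj₁; inj₂)
open import Data.Vec using (_∷_; []; lookup)
open import Data.Vec.Properties using ([]=⇒lookup; lookup⇒[]=; lookup∘tabulate)
open import Function using (_∘_; Equivalence)
open import Relation.Binary.Definitions using (tri<; tri≈; tri>)
open import Relation.Binary.PropositionalEquality hiding ([_])
open import Relation.Nullary using (¬_; Dec; yes; no; does)
open import Relation.Nullary.Decidable using (_×-dec_; _⊎-dec_)

open import Defs hiding (sym)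

∧-true⁻ : ∀ a {b} → (a ∧ b) ≡ true → a ≡ true × b ≡ true
∧-true⁻ true e = refl , e

∧-true⁺ : ∀ {a b} → a ≡ true → b ≡ true → (a ∧ b) ≡ true
∧-true⁺ refl refl = refl

∨-true⁻ : ∀ a {b} → (a ∨ b) ≡ true → a ≡ true ⊎ b ≡ true
∨-true⁻ true  _ = inj₁ refl
∨-true⁻ false e = inj₂ e

∨-trueˡ : ∀ {a} b → a ≡ true → (a ∨ b) ≡ true
∨-trueˡ b refl = refl

∨-trueʳ : ∀ a {b} → b ≡ true → (a ∨ b) ≡ true
∨-trueʳ true  _ = refl
∨-trueʳ false e = e

true≢false : true ≢ false
true≢false ()

flipped-bit : ∀ {a b} → (a ≡ true → b ≡ true) → b ≢ a → a ≡ false × b ≡ true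
flipped-bit {true}  a⇒b b≢a = ⊥-elim (b≢a (a⇒b refl))
flipped-bit {false} {true}  a⇒b b≢a = refl , refl
flipped-bit {false} {false} a⇒b b≢a = ⊥-elim (b≢a refl)

bool-ext : ∀ {a b} → (a ≡ true → b ≡ true) → (b ≡ true → a ≡ true) → a ≡ b
bool-ext {true}  a⇒b _   = sym (a⇒b refl)
bool-ext {false} {true}  _ b⇒a = b⇒a refl
bool-ext {false} {false} _ _   = refl

any-allFin⁻ : ∀ {n} (p : Fin n → Bool) → any p (allFin n) ≡ true → ∃[ x ] p x ≡ true
any-allFin⁻ p = go (allFin _)
  where
  go : ∀ xs → any p xs ≡ true → ∃[ x ] p x ≡ true
  go (x ∷ xs) e with ∨-true⁻ (p x) e
  ... | inj₁ px = x , px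
  ... | inj₂ rest = go xs rest

any-allFin⁺ : ∀ {n} (p : Fin n → Bool) x → p x ≡ true → any p (allFin n) ≡ true
any-allFin⁺ p x px = go (∈-allFin x)
  where
  go : ∀ {xs} → x ∈ xs → any p xs ≡ true
  go {y ∷ ys} (here refl) = ∨-trueˡ _ px
  go {y ∷ ys} (there m)   = ∨-trueʳ (p y) (go m)

any-cong : ∀ {A : Set} {p q : A → Bool} → (∀ x → p x ≡ q x) → ∀ xs → any p xs ≡ any q xs
any-cong e []       = refl
any-cong e (x ∷ xs) = cong₂ _∨_ (e x) (any-cong e xs)

infix 4 _==_

_==_ : ∀ {n} → Fin n → Fin n → Bool
x == y = does (x ≟ᶠ y)

==-refl : ∀ {n} (x : Fin n) → (x == x) ≡ true
==-refl x with x ≟ᶠ x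
... | yes _  = refl
... | no x≢x = ⊥-elim (x≢x refl)

==⇒≡ : ∀ {n} {x y : Fin n} → (x == y) ≡ true → x ≡ y
==⇒≡ {x = x} {y} e with x ≟ᶠ y
... | yes x≡y = x≡y

not-true⇒false : ∀ {b} → not b ≡ true → b ≡ false
not-true⇒false {false} _ = refl

<ᵇ-false⇒≡0 : ∀ d → (0 <ᵇ d) ≡ false → d ≡ 0
<ᵇ-false⇒≡0 zero _ = refl

ind : Bool → ℕ
ind true  = 1
ind false = 0

ind≤1 : ∀ b → ind b ≤ 1
ind≤1 true  = ≤-refl
ind≤1 false = z≤n

ind+m≡m⇒false : ∀ b {m} → ind b + m ≡ m → b ≡ false
ind+m≡m⇒false true  e = ⊥-elim (1+n≢n e)
ind+m≡m⇒false false _ = refl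

count : ∀ {n} → (Fin n → Bool) → ℕ
count {zero}  p = 0
count {suc n} p = if p zero then suc (count (p ∘ suc)) else count (p ∘ suc)

∣p∣≡count : ∀ {n} (p : Subset n) → ∣ p ∣ ≡ count (lookup p)
∣p∣≡count []            = refl
∣p∣≡count (inside ∷ p)  = cong suc (∣p∣≡count p)
∣p∣≡count (outside ∷ p) = ∣p∣≡count p


count≤n : ∀ {n} (p : Fin n → Bool) → count p ≤ n
count≤n {zero}  p = z≤n
count≤n {suc n} p with p zero
... | true  = s≤s (count≤n (p ∘ suc))
... | false = m≤n⇒m≤1+n (count≤n (p ∘ suc))

_⊆ᵇ_ : ∀ {n} → (Fin n → Bool) → (Fin n → Bool) → Set
p ⊆ᵇ q = ∀ x → p x ≡ true → q x ≡ true

count-mono : ∀ {n} {p q : Fin n → Bool} → p ⊆ᵇ q → count p ≤ count q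
count-mono {zero}          p⊆q = z≤n
count-mono {suc n} {p} {q} p⊆q with p zero in pz | q zero in qz
... | true  | true  = s≤s (count-mono (p⊆q ∘ suc))
... | true  | false = ⊥-elim (true≢false (trans (sym (p⊆q zero pz)) qz))
... | false | true  = m≤n⇒m≤1+n (count-mono (p⊆q ∘ suc))
... | false | false = count-mono (p⊆q ∘ suc)

count-strict : ∀ {n} {p q : Fin n → Bool} → p ⊆ᵇ q →
               ∀ x → p x ≡ false → q x ≡ true → count p < count q
count-strict {suc n} {p} {q} p⊆q zero px qx rewrite px | qx = s≤s (count-mono (p⊆q ∘ suc))
count-strict {suc n} {p} {q} p⊆q (suc x) px qx with p zero in pz | q zero in qz
... | true  | true  = s≤s (count-strict (p⊆q ∘ suc) x px qx)
... | true  | false = ⊥-elim (true≢false (trans (sym (p⊆q zero pz)) qz))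
... | false | true  = m≤n⇒m≤1+n (count-strict (p⊆q ∘ suc) x px qx)
... | false | false = count-strict (p⊆q ∘ suc) x px qx

count-split : ∀ {n} (p q : Fin n → Bool) →
              count p ≡ count (λ x → p x ∧ q x) + count (λ x → p x ∧ not (q x))
count-split {zero}  p q = refl
count-split {suc n} p q with p zero | q zero | count-split (p ∘ suc) (q ∘ suc)
... | true  | true  | ih = cong suc ih
... | true  | false | ih = trans (cong suc ih) (sym (+-suc _ _))
... | false | _     | ih = ih

enumerate : ∀ {n} (p : Fin n → Bool) → Fin (count p) → Fin n
enumerate {suc n} p i with p zero
enumerate {suc n} p zero    | true  = zero
enumerate {suc n} p (suc i) | true  = suc (enumerate (p ∘ suc) i)
enumerate {suc n} p i       | false = suc (enumerate (p ∘ suc) i)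

enumerate-sound : ∀ {n} (p : Fin n → Bool) i → p (enumerate p i) ≡ true
enumerate-sound {suc n} p i with p zero in pz
enumerate-sound {suc n} p zero    | true  = pz
enumerate-sound {suc n} p (suc i) | true  = enumerate-sound (p ∘ suc) i
enumerate-sound {suc n} p i       | false = enumerate-sound (p ∘ suc) i

enumerate-injective : ∀ {n} (p : Fin n → Bool) {i j} → enumerate p i ≡ enumerate p j → i ≡ j
enumerate-injective {suc n} p {i} {j} e with p zero
enumerate-injective {suc n} p {zero}  {zero}  e | true  = refl
enumerate-injective {suc n} p {suc i} {suc j} e | true  =
  cong suc (enumerate-injective (p ∘ suc) (fsuc-injective e))
enumerate-injective {suc n} p {i}     {j}     e | false =
  enumerate-injective (p ∘ suc) (fsuc-injective e)

enumerate-complete : ∀ {n} (p : Fin n → Bool) x → p x ≡ true → ∃[ i ] enumerate p i ≡ x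
enumerate-complete {suc n} p x px with p zero in pz
enumerate-complete {suc n} p zero    px | true  = zero , refl
enumerate-complete {suc n} p (suc x) px | true  with enumerate-complete (p ∘ suc) x px
... | i , e = suc i , cong suc e
enumerate-complete {suc n} p zero    px | false = ⊥-elim (true≢false (trans (sym px) pz))
enumerate-complete {suc n} p (suc x) px | false with enumerate-complete (p ∘ suc) x px
... | i , e = i , cong suc e

count-≤-retract : ∀ {n} {p q : Fin n → Bool} (f g : Fin n → Fin n) →
                  (∀ x → p x ≡ true → q (f x) ≡ true) →
                  (∀ x → p x ≡ true → g (f x) ≡ x) → count p ≤ count q
count-≤-retract {p = p} {q} f g fq gf = injective⇒≤ {f = embed} embed-injective
  where
  image : ∀ i → ∃[ j ] enumerate q j ≡ f (enumerate p i)
  image i = enumerate-complete q _ (fq _ (enumerate-sound p i))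
  embed : Fin (count p) → Fin (count q)
  embed i = proj₁ (image i)
  embed-injective : ∀ {i j} → embed i ≡ embed j → i ≡ j
  embed-injective {i} {j} e = enumerate-injective p (begin
    enumerate p i                       ≡⟨ sym (gf _ (enumerate-sound p i)) ⟩
    g (f (enumerate p i))               ≡⟨ cong g (sym (proj₂ (image i))) ⟩
    g (enumerate q (embed i))           ≡⟨ cong (g ∘ enumerate q) e ⟩
    g (enumerate q (embed j))           ≡⟨ cong g (proj₂ (image j)) ⟩
    g (f (enumerate p j))               ≡⟨ gf _ (enumerate-sound p j) ⟩
    enumerate p j                       ∎)
    where open ≡-Reasoning

countResidue : ∀ {n} → (Fin n → Bool) → (Fin n → Fin 3) → Fin 3 → ℕ
countResidue p r c = count (λ x → p x ∧ (r x == c))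

count-by-residue : ∀ {n} (p : Fin n → Bool) (r : Fin n → Fin 3) →
  count p ≡ countResidue p r zero + countResidue p r (suc zero) + countResidue p r (suc (suc zero))
count-by-residue {zero}  p r = refl
count-by-residue {suc n} p r with p zero | r zero | count-by-residue (p ∘ suc) (r ∘ suc)
... | false | _                | ih = ih
... | true  | zero             | ih = cong suc ih
... | true  | suc zero         | ih = trans (cong suc ih)
  (cong (_+ countResidue (p ∘ suc) (r ∘ suc) (suc (suc zero)))
        (sym (+-suc (countResidue (p ∘ suc) (r ∘ suc) zero) (countResidue (p ∘ suc) (r ∘ suc) (suc zero)))))
... | true  | suc (suc zero)   | ih = trans (cong suc ih)
  (sym (+-suc (countResidue (p ∘ suc) (r ∘ suc) zero + countResidue (p ∘ suc) (r ∘ suc) (suc zero))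
              (countResidue (p ∘ suc) (r ∘ suc) (suc (suc zero)))))

-- The least j ≤ m with p j, and m if there is none.
least : (ℕ → Bool) → ℕ → ℕ
least p zero    = 0
least p (suc m) = if p 0 then 0 else suc (least (p ∘ suc) m)

least-≤ : ∀ (p : ℕ → Bool) m → least p m ≤ m
least-≤ p zero    = z≤n
least-≤ p (suc m) with p 0
... | true  = z≤n
... | false = s≤s (least-≤ (p ∘ suc) m)

least-below : ∀ (p : ℕ → Bool) m j → j < least p m → p j ≡ false
least-below p (suc m) j       j< with p 0 in p0
least-below p (suc m) zero    j< | false = p0
least-below p (suc m) (suc j) j< | false = least-below (p ∘ suc) m j (s≤s⁻¹ j<)

least-holds : ∀ (p : ℕ → Bool) m {k} → p k ≡ true → k ≤ m → p (least p m) ≡ true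
least-holds p zero    pk z≤n = pk
least-holds p (suc m) {k} pk k≤ with p 0 in p0
least-holds p (suc m) {k}     pk k≤ | true  = p0
least-holds p (suc m) {zero}  pk k≤ | false = ⊥-elim (true≢false (trans (sym pk) p0))
least-holds p (suc m) {suc k} pk k≤ | false = least-holds (p ∘ suc) m pk (s≤s⁻¹ k≤)

least-≤-witness : ∀ (p : ℕ → Bool) m {k} → p k ≡ true → least p m ≤ k
least-≤-witness p m {k} pk with least p m ≤? k
... | yes ≤k = ≤k
... | no  ≰k = ⊥-elim (true≢false (trans (sym pk) (least-below p m k (≰⇒> ≰k))))

minimal-witness-unique : ∀ (p : ℕ → Bool) {t u} → p t ≡ true → p u ≡ true →
               (∀ i → i < t → p i ≡ false) → (∀ i → i < u → p i ≡ false) → t ≡ u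
minimal-witness-unique p {t} {u} pt pu below-t below-u with <-cmp t u
... | tri< t<u _ _ = ⊥-elim (true≢false (trans (sym pt) (below-u t t<u)))
... | tri≈ _ t≡u _ = t≡u
... | tri> _ _ u<t = ⊥-elim (true≢false (trans (sym pu) (below-t u u<t)))

first : ∀ {n} → (Fin n → Bool) → Maybe (Fin n)
first {zero}  p = nothing
first {suc n} p = if p zero then just zero else Maybe.map suc (first (p ∘ suc))

first-complete : ∀ {n} (p : Fin n → Bool) x → p x ≡ true → ∃[ y ] first p ≡ just y × p y ≡ true
first-complete {suc n} p x px with p zero in p0
... | true = zero , refl , p0
first-complete {suc n} p zero    px | false = ⊥-elim (true≢false (trans (sym px) p0))
first-complete {suc n} p (suc x) px | false with first-complete (p ∘ suc) x px
... | y , e , py rewrite e = suc y , refl , py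

first-cong : ∀ {n} {p q : Fin n → Bool} → (∀ x → p x ≡ q x) → first p ≡ first q
first-cong {zero}          e = refl
first-cong {suc n} {p} {q} e rewrite e zero | first-cong {p = p ∘ suc} {q ∘ suc} (e ∘ suc) = refl

firstOr : ∀ {n} → Fin n → (Fin n → Bool) → Fin n
firstOr x p = fromMaybe x (first p)

firstOr-holds : ∀ {n} (p : Fin n → Bool) {x} y → p y ≡ true → p (firstOr x p) ≡ true
firstOr-holds p y py with first-complete p y py
... | z , e , pz rewrite e = pz

mod3 : ℕ → Fin 3
mod3 zero                = zero
mod3 (suc zero)          = suc zero
mod3 (suc (suc zero))    = suc (suc zero)
mod3 (suc (suc (suc m))) = mod3 m

toℕ-mod3≤ : ∀ m → toℕ (mod3 m) ≤ m
toℕ-mod3≤ zero                = z≤n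
toℕ-mod3≤ (suc zero)          = ≤-refl
toℕ-mod3≤ (suc (suc zero))    = ≤-refl
toℕ-mod3≤ (suc (suc (suc m))) = ≤-trans (toℕ-mod3≤ m) (≤-trans (n≤1+n m) (≤-trans (n≤1+n _) (n≤1+n _)))

small-gap : ∀ {a b} → toℕ (mod3 a) ≡ a → mod3 a ≡ mod3 b → a + 3 ≤ 3 + b
small-gap {a} {b} ta e = ≤-trans (+-monoˡ-≤ 3 a≤b) (≤-reflexive (+-comm b 3))
  where
  a≤b : a ≤ b
  a≤b = subst (_≤ b) (trans (sym (cong toℕ e)) ta) (toℕ-mod3≤ b)

mod3-gap : ∀ {a b} → mod3 a ≡ mod3 b → a < b → a + 3 ≤ b
mod3-gap {suc (suc (suc a))} {suc (suc (suc b))} e (s≤s (s≤s (s≤s a<b))) = s≤s (s≤s (s≤s (mod3-gap e a<b)))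
mod3-gap {zero}             {suc (suc (suc b))} e _ = small-gap {0} refl e
mod3-gap {suc zero}         {suc (suc (suc b))} e _ = small-gap {1} refl e
mod3-gap {suc (suc zero)}   {suc (suc (suc b))} e _ = small-gap {2} refl e
mod3-gap {zero}             {suc zero}          () _
mod3-gap {zero}             {suc (suc zero)}    () _
mod3-gap {suc zero}         {suc (suc zero)}    () _
mod3-gap {suc zero}         {suc zero}          _ (s≤s ())
mod3-gap {suc (suc zero)}   {suc zero}          _ (s≤s ())
mod3-gap {suc (suc zero)}   {suc (suc zero)}    _ (s≤s (s≤s ()))
mod3-gap {suc (suc (suc a))} {suc zero}         _ (s≤s ())
mod3-gap {suc (suc (suc a))} {suc (suc zero)}   _ (s≤s (s≤s ()))

mod3-apart : ∀ a b → mod3 a ≡ mod3 b → a ≡ b ⊎ a + 3 ≤ b ⊎ b + 3 ≤ a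
mod3-apart a b e with <-cmp a b
... | tri< a<b _ _ = inj₂ (inj₁ (mod3-gap e a<b))
... | tri≈ _ a≡b _ = inj₁ a≡b
... | tri> _ _ b<a = inj₂ (inj₂ (mod3-gap (sym e) b<a))

mod3-suc≢ : ∀ m → mod3 (suc m) ≢ mod3 m
mod3-suc≢ m e with mod3-apart (suc m) m e
... | inj₁ sm≡m         = 1+n≢n sm≡m
... | inj₂ (inj₁ sm+3≤m) = m+1+n≰m m (subst (_≤ m) (sym (+-suc m 3)) sm+3≤m)
... | inj₂ (inj₂ m+3≤sm) with +-cancelˡ-≤ m 3 1 (subst (m + 3 ≤_) (+-comm 1 m) m+3≤sm)
...   | s≤s ()

four-times : ∀ m → m + m + m + m ≡ 4 * m
four-times m = begin
  m + m + m + m       ≡⟨ +-assoc (m + m) m m ⟩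
  m + m + (m + m)     ≡⟨ +-assoc m m (m + m) ⟩
  m + (m + (m + m))   ≡⟨ cong (λ t → m + (m + (m + t))) (sym (+-identityʳ m)) ⟩
  4 * m               ∎
  where open ≡-Reasoning

largest : (f : Fin 3 → ℕ) → ∃[ c ] ∀ d → f d ≤ f c
largest f with ≤-total (f (# 0)) (f (# 1)) | ≤-total (f (# 1)) (f (# 2)) | ≤-total (f (# 0)) (f (# 2))
... | _        | inj₁ 1≤2 | inj₁ 0≤2 = # 2 , λ { zero → 0≤2 ; (suc zero) → 1≤2 ; (suc (suc zero)) → ≤-refl }
... | inj₁ 0≤1 | inj₂ 2≤1 | _        = # 1 , λ { zero → 0≤1 ; (suc zero) → ≤-refl ; (suc (suc zero)) → 2≤1 }
... | inj₂ 1≤0 | inj₂ 2≤1 | _        = # 0 , λ { zero → ≤-refl ; (suc zero) → 1≤0 ; (suc (suc zero)) → ≤-trans 2≤1 1≤0 }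
... | _        | inj₁ 1≤2 | inj₂ 2≤0 = # 0 , λ { zero → ≤-refl ; (suc zero) → ≤-trans 1≤2 2≤0 ; (suc (suc zero)) → 2≤0 }

last-applyUpTo : ∀ {A : Set} (f : ℕ → A) p → last (applyUpTo f (suc p)) ≡ just (f p)
last-applyUpTo f zero    = refl
last-applyUpTo f (suc p) = last-applyUpTo (f ∘ suc) p

last-applyDownFrom : ∀ {A : Set} (f : ℕ → A) q → last (applyDownFrom f (suc q)) ≡ just (f 0)
last-applyDownFrom f zero    = refl
last-applyDownFrom f (suc q) = last-applyDownFrom f q

connected-last : ∀ {A : Set} {R : A → A → Set} (xs : List A) {a b} →
                 last xs ≡ just a → R a b → Connected R (last xs) (just b)
connected-last xs e r rewrite e = just r

consec-applyUpTo : ∀ {A : Set} {a b : A} (f : ℕ → A) m → Consec a b (applyUpTo f m) →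
                   ∃[ i ] suc i < m × a ≡ f i × b ≡ f (suc i)
consec-applyUpTo f (suc (suc m)) now = 0 , s≤s (s≤s z≤n) , refl , refl
consec-applyUpTo f (suc m) (later c) with consec-applyUpTo (f ∘ suc) m c
... | i , i< , a≡ , b≡ = suc i , s≤s i< , a≡ , b≡

module GraphProperties {n : ℕ} (G : Graph n) where

  edge-sym : ∀ {u v} → Edge G u v → Edge G v u
  edge-sym {u} {v} = trans (sym (Graph.sym G u v))

  Anticomplete-sym : ∀ {A B} → Anticomplete G A B → Anticomplete G B A
  Anticomplete-sym ac b∈B a∈A = (λ e → proj₁ (ac a∈A b∈B) (sym e))
                              , (λ e → proj₂ (ac a∈A b∈B) (edge-sym e))

module _ {n : ℕ} {G : Graph n} {Z : Subset n} where

  CommonEnd-sym : ∀ {P Q : Transition G Z} → CommonEnd P Q → CommonEnd Q P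
  CommonEnd-sym (inj₁ (inj₁ e)) = inj₁ (inj₁ (sym e))
  CommonEnd-sym (inj₁ (inj₂ e)) = inj₂ (inj₁ (sym e))
  CommonEnd-sym (inj₂ (inj₁ e)) = inj₁ (inj₂ (sym e))
  CommonEnd-sym (inj₂ (inj₂ e)) = inj₂ (inj₂ (sym e))

  CommonEnd? : ∀ (P Q : Transition G Z) → Dec (CommonEnd P Q)
  CommonEnd? P Q = ((start P ≟ᶠ start Q) ⊎-dec (start P ≟ᶠ end Q))
            ⊎-dec ((end P ≟ᶠ start Q) ⊎-dec (end P ≟ᶠ end Q))

module Neighbourhood {n : ℕ} (E : Fin n → Fin n → Bool) where

  expand : (Fin n → Bool) → Fin n → Bool
  expand S x = S x ∨ any (λ y → E x y ∧ S y) (allFin n)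

  within : ℕ → (Fin n → Bool) → Fin n → Bool
  within zero    S = S
  within (suc k) S = expand (within k S)

  expand-cong : ∀ {S₁ S₂} → (∀ x → S₁ x ≡ S₂ x) → ∀ x → expand S₁ x ≡ expand S₂ x
  expand-cong e x = cong₂ _∨_ (e x) (any-cong (λ y → cong (E x y ∧_) (e y)) (allFin n))

  within-suc : ∀ k S x → within k S x ≡ true → within (suc k) S x ≡ true
  within-suc k S x = ∨-trueˡ _

  within-mono : ∀ {k m} S x → k ≤ m → within k S x ≡ true → within m S x ≡ true
  within-mono {k} S x k≤m w with m≤n⇒∃[o]m+o≡n k≤m
  ... | o , refl = go o
    where
    go : ∀ o → within (k + o) S x ≡ true
    go zero    rewrite +-identityʳ k = w
    go (suc o) rewrite +-suc k o     = within-suc (k + o) S x (go o)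

  within-step : ∀ k S x y → E x y ≡ true → within k S y ≡ true → within (suc k) S x ≡ true
  within-step k S x y exy wy =
    ∨-trueʳ (within k S x) (any-allFin⁺ (λ z → E x z ∧ within k S z) y (∧-true⁺ exy wy))

  within-step⁻ : ∀ k S x → within (suc k) S x ≡ true →
                 within k S x ≡ true ⊎ ∃[ y ] E x y ≡ true × within k S y ≡ true
  within-step⁻ k S x w with ∨-true⁻ (within k S x) w
  ... | inj₁ wx = inj₁ wx
  ... | inj₂ wy with any-allFin⁻ _ wy
  ... | y , exy∧wy = inj₂ (y , ∧-true⁻ (E x y) exy∧wy)

  Stable : ℕ → (Fin n → Bool) → Set
  Stable j S = ∀ x → within (suc j) S x ≡ within j S x

  stable-forever : ∀ j S → Stable j S → ∀ i x → within (i + j) S x ≡ within j S x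
  stable-forever j S st zero    x = refl
  stable-forever j S st (suc i) x = trans (expand-cong (stable-forever j S st i) x) (st x)

  -- Each unstable step adds a vertex, so the neighbourhoods stabilise within n steps.
  stabilises-or-grows : ∀ S k → (∃[ j ] j < k × Stable j S) ⊎ k ≤ count (within k S)
  stabilises-or-grows S zero = inj₂ z≤n
  stabilises-or-grows S (suc k) with stabilises-or-grows S k
  ... | inj₁ (j , j<k , st) = inj₁ (j , m≤n⇒m≤1+n j<k , st)
  ... | inj₂ k≤ with all? (λ x → within (suc k) S x ≟ᵇ within k S x)
  ... | yes st = inj₁ (k , ≤-refl , st)
  ... | no ¬st with ¬∀⟶∃¬ n _ (λ x → within (suc k) S x ≟ᵇ within k S x) ¬st
  ... | x , changed with flipped-bit (within-suc k S x) changed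
  ... | old , new = inj₂ (≤-trans (s≤s k≤) (count-strict (within-suc k S) x old new))

  within-saturates : ∀ S k x → within k S x ≡ true → within n S x ≡ true
  within-saturates S k x w with stabilises-or-grows S (suc n)
  ... | inj₂ grows = ⊥-elim (<⇒≱ ≤-refl (≤-trans grows (count≤n (within (suc n) S))))
  ... | inj₁ (j , j<sn , st) with k ≤? n
  ... | yes k≤n = within-mono S x k≤n w
  ... | no  k≰n with m≤n⇒∃[o]m+o≡n (≤-trans (s≤s⁻¹ j<sn) (<⇒≤ (≰⇒> k≰n)))
  ... | o , j+o≡k = within-mono S x (s≤s⁻¹ j<sn)
        (trans (sym (stable-forever j S st o x))
               (trans (cong (λ m → within m S x) (trans (+-comm o j) j+o≡k)) w))

-- The forest F = G ∖ Z and its components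

module Forest {n : ℕ} (G : Graph n) (Z : Subset n) where
  open GraphProperties G public

  InF : Fin n → Set
  InF x = x Sub.∉ Z

  inF? : Fin n → Bool
  inF? x = not (lookup Z x)

  inF?⇒InF : ∀ {x} → inF? x ≡ true → InF x
  inF?⇒InF {x} e x∈Z with lookup Z x | []=⇒lookup x∈Z
  inF?⇒InF () x∈Z | true | refl

  InF⇒inF? : ∀ {x} → InF x → inF? x ≡ true
  InF⇒inF? {x} x∉Z with lookup Z x in e
  ... | false = refl
  ... | true  = ⊥-elim (x∉Z (lookup⇒[]= x Z e))

  N? : Fin n → Bool
  N? x = lookup (Nset G Z) x

  N?⇒∈N : ∀ {x} → N? x ≡ true → x Sub.∈ Nset G Z
  N?⇒∈N {x} = lookup⇒[]= x (Nset G Z)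

  ∈N⇒N? : ∀ {x} → x Sub.∈ Nset G Z → N? x ≡ true
  ∈N⇒N? = []=⇒lookup

  N?⇒InF : ∀ {x} → N? x ≡ true → InF x
  N?⇒InF {x} e = inF?⇒InF (proj₁ (∧-true⁻ (inF? x) (trans (sym (lookup∘tabulate _ x)) e)))

  adjF : Fin n → Fin n → Bool
  adjF x y = inF? x ∧ adj G x y

  open Neighbourhood adjF public

  reach-source : ∀ {u v} → ReachF G Z u v → InF u
  reach-source (here u∉Z)     = u∉Z
  reach-source (step u∉Z _ _) = u∉Z

  reach-target : ∀ {u v} → ReachF G Z u v → InF v
  reach-target (here v∉Z)   = v∉Z
  reach-target (step _ _ r) = reach-target r

  reach-snoc : ∀ {u v w} → ReachF G Z u v → Edge G v w → InF w → ReachF G Z u w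
  reach-snoc (here v∉Z)     vw w∉Z = step v∉Z vw (here w∉Z)
  reach-snoc (step u∉Z e r) vw w∉Z = step u∉Z e (reach-snoc r vw w∉Z)

  reach-trans : ∀ {u v w} → ReachF G Z u v → ReachF G Z v w → ReachF G Z u w
  reach-trans (here _)       r = r
  reach-trans (step u∉Z e q) r = step u∉Z e (reach-trans q r)

  reach-sym : ∀ {u v} → ReachF G Z u v → ReachF G Z v u
  reach-sym (here v∉Z)     = here v∉Z
  reach-sym (step u∉Z e r) = reach-snoc (reach-sym r) (edge-sym e) u∉Z

  reach⇒within : ∀ S k {u x} → within k S u ≡ true → ReachF G Z u x → ∃[ m ] within m S x ≡ true
  reach⇒within S k w (here _) = k , w
  reach⇒within S k w (step _ e r) =
    reach⇒within S (suc k) (within-step k S _ _ (∧-true⁺ (InF⇒inF? (reach-source r)) (edge-sym e)) w) r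

  within⇒reach : ∀ S → (∀ s → S s ≡ true → InF s) → ∀ k x → within k S x ≡ true →
                 ∃[ s ] S s ≡ true × ReachF G Z s x
  within⇒reach S S⊆F zero    x w = x , w , here (S⊆F x w)
  within⇒reach S S⊆F (suc k) x w with within-step⁻ k S x w
  ... | inj₁ w₀ = within⇒reach S S⊆F k x w₀
  ... | inj₂ (y , xy , wy) with within⇒reach S S⊆F k y wy | ∧-true⁻ (inF? x) xy
  ... | s , Ss , r | x∈F , e = s , Ss , reach-snoc r (edge-sym e) (inF?⇒InF x∈F)

  reach? : Fin n → Fin n → Bool
  reach? u = within n (u ==_)

  reach?-sound : ∀ {u v} → InF u → reach? u v ≡ true → ReachF G Z u v
  reach?-sound {u} {v} u∉Z e with within⇒reach (u ==_) (λ s u=s → subst InF (==⇒≡ u=s) u∉Z) n v e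
  ... | s , u=s , r = subst (λ t → ReachF G Z t v) (sym (==⇒≡ u=s)) r

  reach?-complete : ∀ {u v} → ReachF G Z u v → reach? u v ≡ true
  reach?-complete {u} {v} r with reach⇒within (u ==_) 0 (==-refl u) r
  ... | m , w = within-saturates (u ==_) m v w

  reach?-cong : ∀ {u v} → ReachF G Z u v → ∀ w → reach? u w ≡ reach? v w
  reach?-cong uv w = bool-ext
    (λ uw → reach?-complete (reach-trans (reach-sym uv) (reach?-sound (reach-source uv) uw)))
    (λ vw → reach?-complete (reach-trans uv (reach?-sound (reach-target uv) vw)))

  -- The root of a component is its first vertex of N.
  reachableN? : Fin n → Fin n → Bool
  reachableN? x m = N? m ∧ reach? x m

  isRoot : Fin n → Bool
  isRoot r = N? r ∧ maybe (_== r) false (first (reachableN? r))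

  isRoot⇒first : ∀ {r} → isRoot r ≡ true → first (reachableN? r) ≡ just r
  isRoot⇒first {r} e with first (reachableN? r) | ∧-true⁻ (N? r) e
  ... | just y | _ , y=r = cong just (==⇒≡ y=r)

  isRoot⇒InF : ∀ {r} → isRoot r ≡ true → InF r
  isRoot⇒InF {r} e = N?⇒InF (proj₁ (∧-true⁻ (N? r) e))

  first-reach-cong : ∀ {u v} → ReachF G Z u v → first (reachableN? u) ≡ first (reachableN? v)
  first-reach-cong uv = first-cong (λ m → cong (N? m ∧_) (reach?-cong uv m))

  roots-unique : ∀ {r s} → isRoot r ≡ true → isRoot s ≡ true → ReachF G Z r s → r ≡ s
  roots-unique r-root s-root rs = just-injective
    (trans (sym (isRoot⇒first r-root)) (trans (first-reach-cong rs) (isRoot⇒first s-root)))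

  within-roots⇒InF : ∀ k y → within k isRoot y ≡ true → InF y
  within-roots⇒InF k y w with within⇒reach isRoot (λ _ → isRoot⇒InF) k y w
  ... | _ , _ , r = reach-target r

  roots-cover : ComponentsTwoN G Z → ∀ x → InF x → within n isRoot x ≡ true
  roots-cover two x x∉Z with two x x∉Z
  ... | u , _ , _ , u∈N , _ , xu , _
    with first-complete (reachableN? x) u (∧-true⁺ (∈N⇒N? u∈N) (reach?-complete xu))
  ... | m , first≡m , m∈N∧xm with ∧-true⁻ (N? m) m∈N∧xm
  ... | m∈N , xm? = let k , wx = reach⇒within isRoot 0 m-root (reach-sym xm) in within-saturates isRoot k x wx
    where
    xm : ReachF G Z x m
    xm = reach?-sound x∉Z xm?
    m-root : isRoot m ≡ true
    m-root rewrite sym (first-reach-cong xm) | first≡m = ∧-true⁺ m∈N (==-refl m)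

-- Breadth-first layers and the parent function

module Layers {n : ℕ} (G : Graph n) (Z : Subset n) (two : ComponentsTwoN G Z) where
  open Forest G Z public

  depth : Fin n → ℕ
  depth x = least (λ k → within k isRoot x) n

  depth-within : ∀ {x} → InF x → within (depth x) isRoot x ≡ true
  depth-within {x} x∉Z = least-holds (λ k → within k isRoot x) n (roots-cover two x x∉Z) ≤-refl

  depth-≤ : ∀ {x k} → within k isRoot x ≡ true → depth x ≤ k
  depth-≤ {x} = least-≤-witness (λ k → within k isRoot x) n

  depth-edge : ∀ {x y} → InF x → InF y → Edge G x y → depth x ≤ suc (depth y)
  depth-edge {x} {y} x∉Z y∉Z xy =
    depth-≤ (within-step (depth y) isRoot x y (∧-true⁺ (InF⇒inF? x∉Z) xy) (depth-within y∉Z))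

  depth-zero⇒isRoot : ∀ {x} → InF x → depth x ≡ 0 → isRoot x ≡ true
  depth-zero⇒isRoot x∉Z d = subst (λ m → within m isRoot _ ≡ true) d (depth-within x∉Z)

  closer : Fin n → ℕ → Fin n → Bool
  closer x k y = adjF x y ∧ within k isRoot y

  parentAt : Fin n → ℕ → Fin n
  parentAt x zero    = x
  parentAt x (suc k) = firstOr x (closer x k)

  parent : Fin n → Fin n
  parent x = parentAt x (depth x)

  parentAt-closer : ∀ {x k} → InF x → depth x ≡ suc k → closer x k (parentAt x (suc k)) ≡ true
  parentAt-closer {x} {k} x∉Z d
    with within-step⁻ k isRoot x (subst (λ m → within m isRoot x ≡ true) d (depth-within x∉Z))
  ... | inj₁ w = ⊥-elim (<⇒≱ (subst (k <_) (sym d) ≤-refl) (depth-≤ w))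
  ... | inj₂ (y , xy , wy) = firstOr-holds (closer x k) y (∧-true⁺ xy wy)

  module _ {x} (x∉Z : InF x) (pos : 0 < depth x) where

    private
      d : depth x ≡ suc (pred (depth x))
      d = sym (suc-pred (depth x) {{>-nonZero pos}})

      closer-parent : closer x (pred (depth x)) (parent x) ≡ true
      closer-parent = subst (λ m → closer x (pred (depth x)) (parentAt x m) ≡ true) (sym d)
                            (parentAt-closer x∉Z d)

      parent-within : within (pred (depth x)) isRoot (parent x) ≡ true
      parent-within = proj₂ (∧-true⁻ (adjF x (parent x)) closer-parent)

    parent-edge : Edge G x (parent x)
    parent-edge = proj₂ (∧-true⁻ (inF? x) (proj₁ (∧-true⁻ (adjF x (parent x)) closer-parent)))

    parent-InF : InF (parent x)
    parent-InF = within-roots⇒InF (pred (depth x)) (parent x) parent-within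

    depth-parent : depth x ≡ suc (depth (parent x))
    depth-parent = trans d (cong suc (≤-antisym
      (s≤s⁻¹ (subst (_≤ suc (depth (parent x))) d (depth-edge x∉Z parent-InF parent-edge)))
      (depth-≤ parent-within)))

  grandparent≢ : ∀ {x} → InF x → 0 < depth x → 0 < depth (parent x) → parent (parent x) ≢ x
  grandparent≢ {x} x∉Z pos ppos e = 1+n≰n (≤-trans (n≤1+n _) (≤-reflexive (sym (begin
    depth x                            ≡⟨ depth-parent x∉Z pos ⟩
    suc (depth (parent x))             ≡⟨ cong suc (depth-parent (parent-InF x∉Z pos) ppos) ⟩
    suc (suc (depth (parent (parent x)))) ≡⟨ cong (λ z → suc (suc (depth z))) e ⟩
    suc (suc (depth x))                ∎))))
    where open ≡-Reasoning

  private
    below-parent : ∀ {i x} → InF x → suc i ≤ depth x → i ≤ depth (parent x)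
    below-parent x∉Z i< = s≤s⁻¹ (subst (_ ≤_) (depth-parent x∉Z (≤-trans (s≤s z≤n) i<)) i<)

  ancestor : Fin n → ℕ → Fin n
  ancestor x zero    = x
  ancestor x (suc i) = ancestor (parent x) i

  ancestor-+ : ∀ i j x → ancestor x (i + j) ≡ ancestor (ancestor x i) j
  ancestor-+ zero    j x = refl
  ancestor-+ (suc i) j x = ancestor-+ i j (parent x)

  ancestor-suc : ∀ i x → ancestor x (suc i) ≡ parent (ancestor x i)
  ancestor-suc i x = trans (cong (ancestor x) (+-comm 1 i)) (ancestor-+ i 1 x)

  ancestor-InF : ∀ i {x} → InF x → i ≤ depth x → InF (ancestor x i)
  ancestor-InF zero    x∉Z _  = x∉Z
  ancestor-InF (suc i) x∉Z i< = ancestor-InF i (parent-InF x∉Z (≤-trans (s≤s z≤n) i<)) (below-parent x∉Z i<)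

  ancestor-depth : ∀ i {x} → InF x → i ≤ depth x → depth (ancestor x i) ≡ depth x ∸ i
  ancestor-depth zero    x∉Z _  = refl
  ancestor-depth (suc i) {x} x∉Z i< =
    trans (ancestor-depth i (parent-InF x∉Z pos) (below-parent x∉Z i<))
          (cong (_∸ suc i) (sym (depth-parent x∉Z pos)))
    where
    pos : 0 < depth x
    pos = ≤-trans (s≤s z≤n) i<

  ancestor-reach : ∀ i {x} → InF x → i ≤ depth x → ReachF G Z x (ancestor x i)
  ancestor-reach zero    x∉Z _  = here x∉Z
  ancestor-reach (suc i) {x} x∉Z i< =
    step x∉Z (parent-edge x∉Z pos) (ancestor-reach i (parent-InF x∉Z pos) (below-parent x∉Z i<))
    where
    pos : 0 < depth x
    pos = ≤-trans (s≤s z≤n) i<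

  ancestor-pos : ∀ i {x} → InF x → i < depth x → 0 < depth (ancestor x i)
  ancestor-pos i x∉Z i< = subst (0 <_) (sym (ancestor-depth i x∉Z (<⇒≤ i<))) (m<n⇒0<n∸m i<)

  ancestor-edge : ∀ i {x} → InF x → i < depth x → Edge G (ancestor x i) (ancestor x (suc i))
  ancestor-edge i {x} x∉Z i< = subst (Edge G (ancestor x i)) (sym (ancestor-suc i x))
    (parent-edge (ancestor-InF i x∉Z (<⇒≤ i<)) (ancestor-pos i x∉Z i<))

  ancestor-injective : ∀ {i j x} → InF x → i ≤ depth x → j ≤ depth x → ancestor x i ≡ ancestor x j → i ≡ j
  ancestor-injective {i} {j} x∉Z i≤ j≤ e = ∸-cancelˡ-≡ i≤ j≤
    (trans (sym (ancestor-depth i x∉Z i≤)) (trans (cong depth e) (ancestor-depth j x∉Z j≤)))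

  rootOf : Fin n → Fin n
  rootOf x = ancestor x (depth x)

  rootOf-isRoot : ∀ {x} → InF x → isRoot (rootOf x) ≡ true
  rootOf-isRoot {x} x∉Z = depth-zero⇒isRoot (ancestor-InF (depth x) x∉Z ≤-refl)
    (trans (ancestor-depth (depth x) x∉Z ≤-refl) (n∸n≡0 (depth x)))

  rootOf-cong : ∀ {x y} → ReachF G Z x y → rootOf x ≡ rootOf y
  rootOf-cong {x} {y} xy = roots-unique (rootOf-isRoot x∉Z) (rootOf-isRoot y∉Z)
    (reach-trans (reach-sym (ancestor-reach (depth x) x∉Z ≤-refl))
                 (reach-trans xy (ancestor-reach (depth y) y∉Z ≤-refl)))
    where
    x∉Z : InF x
    x∉Z = reach-source xy
    y∉Z : InF y
    y∉Z = reach-target xy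

-- Every edge of F joins a vertex to its parent

module Tree {n : ℕ} (G : Graph n) (Z : Subset n) (two : ComponentsTwoN G Z) (hit : CycleHitting G Z) where
  open Layers G Z two public

  IsParentOf : Fin n → Fin n → Set
  IsParentOf y x = 0 < depth x × y ≡ parent x

  -- The cycle runs from x up to the first common ancestor ancestor x p = ancestor y q and down to y.
  module AncestorCycle {x y} (x∉Z : InF x) (y∉Z : InF y) (xy : Edge G x y)
      (y∤x : ¬ IsParentOf y x) (x∤y : ¬ IsParentOf x y)
      (p q : ℕ) (p≤ : p ≤ depth x) (q≤ : q ≤ depth y) (meet : ancestor y q ≡ ancestor x p)
      (meet-first : ∀ i j → i < p → j ≤ depth y → ancestor y j ≢ ancestor x i) where

    up : List (Fin n)
    up = applyUpTo (ancestor x) (suc p)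

    down : List (Fin n)
    down = applyDownFrom (ancestor y) q

    unique-up : Unique up
    unique-up = Uniqueₚ.applyUpTo⁺₁ (ancestor x) (suc p) λ i<j j<p e →
      <⇒≢ i<j (ancestor-injective x∉Z (≤-trans (<⇒≤ i<j) (s≤s⁻¹ (≤-trans j<p (s≤s p≤))))
                                      (s≤s⁻¹ (≤-trans j<p (s≤s p≤))) e)

    unique-down : Unique down
    unique-down = Uniqueₚ.applyDownFrom⁺₁ (ancestor y) q λ j<i i<q e →
      <⇒≢ j<i (sym (ancestor-injective y∉Z (≤-trans (<⇒≤ i<q) q≤)
                                           (≤-trans (<⇒≤ (<-trans j<i i<q)) q≤) e))

    disjoint : ∀ {v} → ¬ (v ∈ up × v ∈ down)
    disjoint (v∈up , v∈down) with ∈-applyUpTo⁻ (ancestor x) v∈up | ∈-applyDownFrom⁻ (ancestor y) v∈down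
    ... | i , i≤p , refl | j , j<q , e with <-cmp i p
    ... | tri< i<p _ _ = meet-first i j i<p (≤-trans (<⇒≤ j<q) q≤) (sym e)
    ... | tri≈ _ refl _ = <⇒≢ j<q (ancestor-injective y∉Z (≤-trans (<⇒≤ j<q) q≤) q≤ (trans (sym e) (sym meet)))
    ... | tri> _ _ i>p = <⇒≱ i>p (s≤s⁻¹ i≤p)

    linked-up : Linked (Edge G) up
    linked-up = Linkedₚ.applyUpTo⁺₁ (ancestor x) (suc p) λ {i} i< → ancestor-edge i x∉Z (≤-trans (s≤s⁻¹ i<) p≤)

    closed : ∀ k → k ≤ depth y → ancestor y k ≡ ancestor x p →
             Linked (Edge G) (up ++ applyDownFrom (ancestor y) k ++ [ x ])
    closed zero _ m = Linkedₚ.++⁺ linked-up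
      (connected-last up (last-applyUpTo (ancestor x) p) (subst (λ z → Edge G z x) m (edge-sym xy))) [-]
    closed (suc k) k< m = Linkedₚ.++⁺ linked-up
      (connected-last up (last-applyUpTo (ancestor x) p)
        (subst (λ z → Edge G z (ancestor y k)) m (edge-sym (ancestor-edge k y∉Z k<))))
      (Linkedₚ.++⁺ (Linkedₚ.applyDownFrom⁺₁ (ancestor y) (suc k)
                     λ {i} i< → edge-sym (ancestor-edge i y∉Z (≤-trans (<⇒≤ i<) k<)))
                   (connected-last (applyDownFrom (ancestor y) (suc k))
                     (last-applyDownFrom (ancestor y) k) (edge-sym xy)) [-])

    three≤length : ∀ p q → p ≤ depth x → q ≤ depth y → ancestor y q ≡ ancestor x p → 3 ≤ suc p + q
    three≤length zero zero _ _ y≡x with trans (sym (subst (Edge G x) y≡x xy)) (irrefl G x)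
    ... | ()
    three≤length zero          (suc zero)    _  q≤ m = ⊥-elim (x∤y (q≤ , sym m))
    three≤length (suc zero)    zero          p≤ _  m = ⊥-elim (y∤x (p≤ , m))
    three≤length zero          (suc (suc _)) _  _  _ = s≤s (s≤s (s≤s z≤n))
    three≤length (suc (suc _)) zero          _  _  _ = s≤s (s≤s (s≤s z≤n))
    three≤length (suc a)       (suc b)       _  _  _ = s≤s (s≤s (subst (1 ≤_) (sym (+-suc a b)) (s≤s z≤n)))

    cycle : Cycle G
    cycle = record
      { cverts  = up ++ down
      ; clen    = subst (3 ≤_) (sym length-up++down) (three≤length p q p≤ q≤ meet)
      ; cuniq   = Uniqueₚ.++⁺ unique-up unique-down disjoint
      ; cclosed = subst (Linked (Edge G)) (sym (++-assoc up down [ x ])) (closed q q≤ meet)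
      }
      where
      length-up++down : length (up ++ down) ≡ suc p + q
      length-up++down = trans (length-++ up)
        (cong₂ _+_ (length-applyUpTo (ancestor x) (suc p)) (length-applyDownFrom (ancestor y) q))

    cycle-inside-F : ∀ {v} → v ∈ cverts cycle → InF v
    cycle-inside-F v∈cycle with ∈-++⁻ up v∈cycle
    ... | inj₁ v∈up with ∈-applyUpTo⁻ (ancestor x) v∈up
    ... | i , i≤p , refl = ancestor-InF i x∉Z (≤-trans (s≤s⁻¹ i≤p) p≤)
    cycle-inside-F v∈cycle | inj₂ v∈down with ∈-applyDownFrom⁻ (ancestor y) v∈down
    ... | j , j<q , refl = ancestor-InF j y∉Z (≤-trans (<⇒≤ j<q) q≤)

  -- Depths decrease by one along ancestors, so ancestor x i lies above y iff it is
  -- the ancestor of y with the same depth.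
  aboveOf : Fin n → Fin n → ℕ → Bool
  aboveOf x y i = ancestor y (depth y ∸ (depth x ∸ i)) == ancestor x i

  no-cross-edge : ∀ {x y} → InF x → InF y → Edge G x y → ¬ IsParentOf y x → ¬ IsParentOf x y → ⊥
  no-cross-edge {x} {y} x∉Z y∉Z xy y∤x x∤y =
    let v , v∈cycle , v∈Z = hit cycle in cycle-inside-F v∈cycle v∈Z
    where
    root-above : aboveOf x y (depth x) ≡ true
    root-above rewrite n∸n≡0 (depth x) =
      subst (λ z → (z == rootOf x) ≡ true) (rootOf-cong (step x∉Z xy (here y∉Z))) (==-refl (rootOf x))
    p : ℕ
    p = least (aboveOf x y) (depth x)
    q : ℕ
    q = depth y ∸ (depth x ∸ p)
    p≤ : p ≤ depth x
    p≤ = least-≤ (aboveOf x y) (depth x)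
    meet : ancestor y q ≡ ancestor x p
    meet = ==⇒≡ (least-holds (aboveOf x y) (depth x) root-above ≤-refl)
    meet-first : ∀ i j → i < p → j ≤ depth y → ancestor y j ≢ ancestor x i
    meet-first i j i<p j≤ e = true≢false (trans (sym above) (least-below (aboveOf x y) (depth x) i i<p))
      where
      same-depth : depth y ∸ j ≡ depth x ∸ i
      same-depth = trans (sym (ancestor-depth j y∉Z j≤))
                         (trans (cong depth e) (ancestor-depth i x∉Z (≤-trans (<⇒≤ i<p) p≤)))
      above : aboveOf x y i ≡ true
      above rewrite sym same-depth | m∸[m∸n]≡n j≤ =
        subst (λ z → (z == ancestor x i) ≡ true) (sym e) (==-refl (ancestor x i))
    open AncestorCycle x∉Z y∉Z xy y∤x x∤y p q p≤ (m∸n≤m (depth y) (depth x ∸ p)) meet meet-first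

  parent-edges : ∀ {x y} → InF x → InF y → Edge G x y → IsParentOf y x ⊎ IsParentOf x y
  parent-edges {x} {y} x∉Z y∉Z xy with (0 <? depth x) ×-dec (y ≟ᶠ parent x)
  ... | yes y∣x = inj₁ y∣x
  ... | no  y∤x with (0 <? depth y) ×-dec (x ≟ᶠ parent y)
  ... | yes x∣y = inj₂ x∣y
  ... | no  x∤y = ⊥-elim (no-cross-edge x∉Z y∉Z xy y∤x x∤y)

-- Levels and transitions

module Transitions {n : ℕ} (G : Graph n) (Z : Subset n) (two : ComponentsTwoN G Z) (hit : CycleHitting G Z) where
  open Tree G Z two hit public

  levelAt : ℕ → Fin n → ℕ
  levelAt zero    x = ind (N? x)
  levelAt (suc i) x = ind (N? x) + levelAt i (parent x)

  level : Fin n → ℕ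
  level x = levelAt (depth x) x

  level-parent : ∀ {x} → InF x → 0 < depth x → level x ≡ ind (N? x) + level (parent x)
  level-parent {x} x∉Z pos = cong (λ d → levelAt d x) (depth-parent x∉Z pos)

  level-positive : ∀ {x} → InF x → 1 ≤ level x
  level-positive x∉Z = by-depth _ x∉Z refl
    where
    by-depth : ∀ d {x} → InF x → depth x ≡ d → 1 ≤ level x
    by-depth zero {x} x∉Z d rewrite d | proj₁ (∧-true⁻ (N? x) (depth-zero⇒isRoot x∉Z d)) = ≤-refl
    by-depth (suc d) {x} x∉Z dx = ≤-trans
      (by-depth d (parent-InF x∉Z pos) (suc-injective (trans (sym (depth-parent x∉Z pos)) dx)))
      (≤-trans (m≤n+m _ (ind (N? x))) (≤-reflexive (sym (level-parent x∉Z pos))))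
      where
      pos : 0 < depth x
      pos = subst (0 <_) (sym dx) z<s

  level-edge : ∀ {x y} → InF x → InF y → Edge G x y → level x ≤ suc (level y)
  level-edge {x} {y} x∉Z y∉Z xy with parent-edges x∉Z y∉Z xy
  ... | inj₁ (pos , refl) = ≤-trans (≤-reflexive (level-parent x∉Z pos)) (+-monoˡ-≤ _ (ind≤1 (N? x)))
  ... | inj₂ (pos , refl) = m≤n⇒m≤1+n
    (≤-trans (m≤n+m _ (ind (N? y))) (≤-reflexive (sym (level-parent y∉Z pos))))

  module TransitionFrom {v} (v∈N : N? v ≡ true) (pos : 0 < depth v) where

    v∉Z : InF v
    v∉Z = N?⇒InF v∈N

    endsAt : ℕ → Bool
    endsAt i = N? (ancestor v (suc i))

    K : ℕ
    K = pred (depth v)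

    depth≡ : depth v ≡ suc K
    depth≡ = sym (suc-pred (depth v) {{>-nonZero pos}})

    s : ℕ
    s = least endsAt K

    endsAt-s : endsAt s ≡ true
    endsAt-s = least-holds endsAt K (proj₁ (∧-true⁻ (N? _) root-isRoot)) ≤-refl
      where
      root-isRoot : isRoot (ancestor v (suc K)) ≡ true
      root-isRoot = subst (λ d → isRoot (ancestor v d) ≡ true) depth≡ (rootOf-isRoot v∉Z)

    s<depth : suc s ≤ depth v
    s<depth = subst (suc s ≤_) (sym depth≡) (s≤s (least-≤ endsAt K))

    last-vertex : Fin n
    last-vertex = ancestor v (suc s)

    inner : List (Fin n)
    inner = applyUpTo (ancestor v ∘ suc) s

    vertices≡ : v ∷ inner ++ [ last-vertex ] ≡ applyUpTo (ancestor v) (suc (suc s))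
    vertices≡ = cong (v ∷_) (applyUpTo-∷ʳ (ancestor v ∘ suc) s)

    ∈vertices : ∀ {a} → a ∈ v ∷ inner ++ [ last-vertex ] → ∃[ i ] i ≤ suc s × a ≡ ancestor v i
    ∈vertices {a} a∈ with ∈-applyUpTo⁻ (ancestor v) (subst (a ∈_) vertices≡ a∈)
    ... | i , i< , e = i , s≤s⁻¹ i< , e

    ancestor≤-InF : ∀ {i} → i ≤ suc s → InF (ancestor v i)
    ancestor≤-InF i≤ = ancestor-InF _ v∉Z (≤-trans i≤ s<depth)

    transition : Transition G Z
    transition = record
      { start   = v
      ; mid     = inner
      ; end     = last-vertex
      ; tuniq   = subst Unique (sym vertices≡) (Uniqueₚ.applyUpTo⁺₁ (ancestor v) (suc (suc s)) λ i<j j< e →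
                    <⇒≢ i<j (ancestor-injective v∉Z (≤-trans (<⇒≤ i<j) (below j<)) (below j<) e))
      ; tpath   = subst (Linked (Edge G)) (sym vertices≡) (Linkedₚ.applyUpTo⁺₁ (ancestor v) (suc (suc s))
                    λ {i} i< → ancestor-edge i v∉Z (below i<))
      ; tinF    = All.tabulate λ a∈ → let i , i≤ , e = ∈vertices a∈ in subst InF (sym e) (ancestor≤-InF i≤)
      ; startN  = N?⇒∈N v∈N
      ; endN    = N?⇒∈N endsAt-s
      ; midNotN = All.tabulate λ a∈ → let i , i<s , e = ∈-applyUpTo⁻ (ancestor v ∘ suc) a∈ in
                    λ a∈N → true≢false (trans (sym (∈N⇒N? (subst (Sub._∈ Nset G Z) e a∈N)))
                                              (least-below endsAt K i i<s))
      }
      where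
      below : ∀ {j} → j < suc (suc s) → j ≤ depth v
      below j< = ≤-trans (s≤s⁻¹ j<) s<depth

    Inner : Fin n → Set
    Inner a = ∃[ j ] j ≤ s × a ≡ ancestor v (suc j)

    ∈transition : ∀ {a} → a ∈ tverts transition → a ≡ v ⊎ Inner a
    ∈transition a∈ with ∈vertices a∈
    ... | zero  , _  , e = inj₁ e
    ... | suc j , j≤ , e = inj₂ (j , s≤s⁻¹ j≤ , e)

    inner-InF : ∀ {a} → Inner a → InF a
    inner-InF (j , j≤ , refl) = ancestor≤-InF (s≤s j≤)

    inner-not-N : ∀ {j} → j < s → N? (ancestor v (suc j)) ≡ false
    inner-not-N = least-below endsAt K _

    parent-inner : Inner (parent v)
    parent-inner = 0 , z≤n , refl

    inner-parent : ∀ {a} → Inner a → N? a ≡ false → Inner (parent a)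
    inner-parent {a} (j , j≤ , refl) a∉N with m≤n⇒m<n∨m≡n j≤
    ... | inj₁ j<s = suc j , j<s , sym (ancestor-suc (suc j) v)
    ... | inj₂ refl = ⊥-elim (true≢false (trans (sym endsAt-s) a∉N))

    private
      level-inner-constant : ∀ j → j ≤ s → level (ancestor v (suc j)) ≡ level (parent v)
      level-inner-constant zero    _  = refl
      level-inner-constant (suc j) j< = trans (sym level-step) (level-inner-constant j (<⇒≤ j<))
        where
        a : Fin n
        a = ancestor v (suc j)
        level-step : level a ≡ level (ancestor v (suc (suc j)))
        level-step = begin
          level a                              ≡⟨ level-parent (ancestor≤-InF (s≤s (<⇒≤ j<))) a-pos ⟩
          ind (N? a) + level (parent a)        ≡⟨ cong₂ _+_ (cong ind (inner-not-N j<))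
                                                           (cong level (sym (ancestor-suc (suc j) v))) ⟩
          level (ancestor v (suc (suc j)))     ∎
          where
          open ≡-Reasoning
          a-pos : 0 < depth a
          a-pos = ancestor-pos (suc j) v∉Z (≤-trans (s≤s j<) s<depth)

    level-inner : ∀ {a} → Inner a → level v ≡ suc (level a)
    level-inner (j , j≤ , refl) = begin
      level v                          ≡⟨ level-parent v∉Z pos ⟩
      ind (N? v) + level (parent v)    ≡⟨ cong (λ b → ind b + level (parent v)) v∈N ⟩
      suc (level (parent v))           ≡⟨ cong suc (sym (level-inner-constant j j≤)) ⟩
      suc (level (ancestor v (suc j))) ∎
      where open ≡-Reasoning

    level-transition : ∀ {a} → a ∈ tverts transition → level a ≤ level v × level v ≤ suc (level a)
    level-transition a∈ with ∈transition a∈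
    ... | inj₁ refl = ≤-refl , n≤1+n _
    ... | inj₂ a∈inner = ≤-trans (n≤1+n _) (≤-reflexive (sym (level-inner a∈inner)))
                       , ≤-reflexive (level-inner a∈inner)

    inner-reaches-end : ∀ {a} → Inner a → ∃[ t ] last-vertex ≡ ancestor a t ×
                        N? (ancestor a t) ≡ true × (∀ i → i < t → N? (ancestor a i) ≡ false)
    inner-reaches-end (j , j≤ , refl) = s ∸ j , last≡ , subst (λ z → N? z ≡ true) last≡ endsAt-s , below
      where
      last≡ : last-vertex ≡ ancestor (ancestor v (suc j)) (s ∸ j)
      last≡ = trans (cong (ancestor v ∘ suc) (sym (m+[n∸m]≡n j≤))) (ancestor-+ (suc j) (s ∸ j) v)
      below : ∀ i → i < s ∸ j → N? (ancestor (ancestor v (suc j)) i) ≡ false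
      below i i< = trans (cong N? (sym (ancestor-+ (suc j) i v)))
                         (inner-not-N (subst (j + i <_) (m+[n∸m]≡n j≤) (+-monoʳ-< j i<)))

  inner-shared : ∀ {v w} (v∈N : N? v ≡ true) (v-pos : 0 < depth v) (w∈N : N? w ≡ true) (w-pos : 0 < depth w) →
    ∀ {a} → TransitionFrom.Inner v∈N v-pos a → TransitionFrom.Inner w∈N w-pos a →
    TransitionFrom.last-vertex v∈N v-pos ≡ TransitionFrom.last-vertex w∈N w-pos
  inner-shared v∈N v-pos w∈N w-pos {a} a∈v a∈w
    with TransitionFrom.inner-reaches-end v∈N v-pos a∈v | TransitionFrom.inner-reaches-end w∈N w-pos a∈w
  ... | t , end-v , t∈N , below-t | u , end-w , u∈N , below-u =
    trans end-v (trans (cong (ancestor a) (minimal-witness-unique (N? ∘ ancestor a) t∈N u∈N below-t below-u)) (sym end-w))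

  module TransitionPair {v w} (v∈N : N? v ≡ true) (v-pos : 0 < depth v)
                              (w∈N : N? w ≡ true) (w-pos : 0 < depth w) where
    module V = TransitionFrom v∈N v-pos
    module W = TransitionFrom w∈N w-pos

    Tv Tw : Transition G Z
    Tv = V.transition
    Tw = W.transition

    shared-inner : ∀ {a} → V.Inner a → W.Inner a → CommonEnd Tv Tw
    shared-inner a∈v a∈w = inj₂ (inj₂ (inner-shared v∈N v-pos w∈N w-pos a∈v a∈w))

    module SameLevel (same : level v ≡ level w) where

      shared-vertex : ∀ {a} → a ∈ tverts Tv → a ∈ tverts Tw → CommonEnd Tv Tw
      shared-vertex a∈v a∈w with V.∈transition a∈v | W.∈transition a∈w
      ... | inj₁ refl  | inj₁ refl  = inj₁ (inj₁ refl)
      ... | inj₁ refl  | inj₂ a∈Iw = ⊥-elim (1+n≢n (sym (trans same (W.level-inner a∈Iw))))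
      ... | inj₂ a∈Iv | inj₁ refl  = ⊥-elim (1+n≢n (sym (trans (sym same) (V.level-inner a∈Iv))))
      ... | inj₂ a∈Iv | inj₂ a∈Iw = shared-inner a∈Iv a∈Iw

      parent-edge-between : ∀ {a} → a ∈ tverts Tv → parent a ∈ tverts Tw → 0 < depth a → CommonEnd Tv Tw
      parent-edge-between {a} a∈v pa∈w a-pos with V.∈transition a∈v | W.∈transition pa∈w
      ... | inj₁ a≡v   | inj₁ pa≡w   = ⊥-elim (1+n≢n (sym (begin
        level w                          ≡⟨ sym same ⟩
        level v                          ≡⟨ level-parent V.v∉Z v-pos ⟩
        ind (N? v) + level (parent v)    ≡⟨ cong₂ (λ b z → ind b + level z) v∈N (trans (cong parent (sym a≡v)) pa≡w) ⟩
        suc (level w)                    ∎)))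
        where open ≡-Reasoning
      ... | inj₁ a≡v   | inj₂ pa∈Iw = shared-inner V.parent-inner (subst W.Inner (cong parent a≡v) pa∈Iw)
      ... | inj₂ a∈Iv | inj₁ pa≡w   =
        ⊥-elim (1+n≰n (subst (_≤ level a) (trans (sym same) (V.level-inner a∈Iv)) w≤a))
        where
        w≤a : level w ≤ level a
        w≤a = ≤-trans (m≤n+m _ (ind (N? a))) (≤-reflexive (sym
          (trans (level-parent (V.inner-InF a∈Iv) a-pos) (cong (λ z → ind (N? a) + level z) pa≡w))))
      ... | inj₂ a∈Iv | inj₂ pa∈Iw = shared-inner (V.inner-parent a∈Iv a∉N) pa∈Iw
        where
        equal-levels : ind (N? a) + level (parent a) ≡ level (parent a)
        equal-levels = trans (sym (level-parent (V.inner-InF a∈Iv) a-pos))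
          (suc-injective (trans (sym (V.level-inner a∈Iv)) (trans same (W.level-inner pa∈Iw))))
        a∉N : N? a ≡ false
        a∉N = ind+m≡m⇒false (N? a) equal-levels

    far-apart : level v + 3 ≤ level w → Anticomplete G (tverts Tv) (tverts Tw)
    far-apart gap {a} {b} a∈ b∈ = a≢b , no-edge
      where
      gap-ab : suc (suc (level a)) ≤ level b
      gap-ab = s≤s⁻¹ (begin
        3 + level a    ≤⟨ +-monoʳ-≤ 3 (proj₁ (V.level-transition a∈)) ⟩
        3 + level v    ≡⟨ +-comm 3 (level v) ⟩
        level v + 3    ≤⟨ gap ⟩
        level w        ≤⟨ proj₂ (W.level-transition b∈) ⟩
        suc (level b)  ∎)
        where open ≤-Reasoning
      a≢b : a ≢ b
      a≢b refl = 1+n≰n (≤-trans (n≤1+n _) gap-ab)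
      no-edge : ¬ Edge G a b
      no-edge ab = 1+n≰n (≤-trans gap-ab
        (level-edge (All.lookup (tinF Tw) b∈) (All.lookup (tinF Tv) a∈) (edge-sym ab)))

  transitionFrom : ∀ {v} → N? v ≡ true → 0 < depth v → Transition G Z
  transitionFrom = TransitionFrom.transition

  same-level-normal : ∀ {v w} (v∈N : N? v ≡ true) (v-pos : 0 < depth v) (w∈N : N? w ≡ true) (w-pos : 0 < depth w) →
    level v ≡ level w →
    Anticomplete G (tverts (transitionFrom v∈N v-pos)) (tverts (transitionFrom w∈N w-pos))
    ⊎ CommonEnd (transitionFrom v∈N v-pos) (transitionFrom w∈N w-pos)
  same-level-normal v∈N v-pos w∈N w-pos same
    with CommonEnd? (transitionFrom v∈N v-pos) (transitionFrom w∈N w-pos)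
  ... | yes ce = inj₂ ce
  ... | no ¬ce = inj₁ λ a∈ b∈ →
        (λ a≡b → ¬ce (shared-vertex a∈ (subst (_∈ tverts Tw) (sym a≡b) b∈)))
      , (λ ab → ¬ce (edge-between a∈ b∈ ab))
    where
    open TransitionPair v∈N v-pos w∈N w-pos
    open SameLevel same
    edge-between : ∀ {a b} → a ∈ tverts Tv → b ∈ tverts Tw → Edge G a b → CommonEnd Tv Tw
    edge-between {a} {b} a∈ b∈ ab with parent-edges (All.lookup (tinF Tv) a∈) (All.lookup (tinF Tw) b∈) ab
    ... | inj₁ (a-pos , b≡pa) = parent-edge-between a∈ (subst (_∈ tverts Tw) b≡pa b∈) a-pos
    ... | inj₂ (b-pos , a≡pb) = CommonEnd-sym {P = Tw} {Q = Tv}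
      (TransitionPair.SameLevel.parent-edge-between w∈N w-pos v∈N v-pos (sym same)
         b∈ (subst (_∈ tverts Tv) a≡pb a∈) b-pos)

-- The normal family of one residue class

module Construction {n : ℕ} (G : Graph n) (Z : Subset n) (two : ComponentsTwoN G Z) (hit : CycleHitting G Z) where
  open Transitions G Z two hit public

  positive? : Fin n → Bool
  positive? x = 0 <ᵇ depth x

  nonRootN : Fin n → Bool
  nonRootN x = N? x ∧ positive? x

  rootN : Fin n → Bool
  rootN x = N? x ∧ not (positive? x)

  residue : Fin n → Fin 3
  residue = mod3 ∘ level

  inClass : Fin 3 → Fin n → Bool
  inClass c x = nonRootN x ∧ (residue x == c)

  module _ {c x} (x∈c : inClass c x ≡ true) where

    inClass-N : N? x ≡ true
    inClass-N = proj₁ (∧-true⁻ (N? x) (proj₁ (∧-true⁻ (nonRootN x) x∈c)))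

    inClass-positive : 0 < depth x
    inClass-positive = <ᵇ⇒< 0 (depth x)
      (Equivalence.from T-≡ (proj₂ (∧-true⁻ (N? x) (proj₁ (∧-true⁻ (nonRootN x) x∈c)))))

    inClass-residue : residue x ≡ c
    inClass-residue = ==⇒≡ (proj₂ (∧-true⁻ (nonRootN x) x∈c))

  module Class (c : Fin 3) where

    size : ℕ
    size = count (inClass c)

    vertex : Fin size → Fin n
    vertex = enumerate (inClass c)

    vertex∈c : ∀ i → inClass c (vertex i) ≡ true
    vertex∈c = enumerate-sound (inClass c)

    vertex-N : ∀ i → N? (vertex i) ≡ true
    vertex-N i = inClass-N (vertex∈c i)

    vertex-pos : ∀ i → 0 < depth (vertex i)
    vertex-pos i = inClass-positive (vertex∈c i)

    family : Fin size → Transition G Z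
    family i = transitionFrom (vertex-N i) (vertex-pos i)

    module T (i : Fin size) = TransitionFrom (vertex-N i) (vertex-pos i)
    module P (i j : Fin size) = TransitionPair (vertex-N i) (vertex-pos i) (vertex-N j) (vertex-pos j)

    same-residue : ∀ i j → mod3 (level (vertex i)) ≡ mod3 (level (vertex j))
    same-residue i j = trans (inClass-residue (vertex∈c i)) (sym (inClass-residue (vertex∈c j)))

    anticomplete-or-common-end : ∀ i j →
      Anticomplete G (tverts (family i)) (tverts (family j)) ⊎ CommonEnd (family i) (family j)
    anticomplete-or-common-end i j with mod3-apart (level (vertex i)) (level (vertex j)) (same-residue i j)
    ... | inj₁ same       = same-level-normal (vertex-N i) (vertex-pos i) (vertex-N j) (vertex-pos j) same
    ... | inj₂ (inj₁ gap) = inj₁ (P.far-apart i j gap)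
    ... | inj₂ (inj₂ gap) = inj₁ (Anticomplete-sym (P.far-apart j i gap))

    distinct : Distinct family
    distinct i j i≢j (inj₁ same) = i≢j (enumerate-injective (inClass c) (∷-injectiveˡ same))
    distinct i j i≢j (inj₂ reversed) = mod3-suc≢ (level (T.last-vertex j)) (begin
      mod3 (suc (level (T.last-vertex j))) ≡⟨ cong mod3 (sym (T.level-inner j (T.s j , ≤-refl , refl))) ⟩
      mod3 (level (vertex j))              ≡⟨ same-residue j i ⟩
      mod3 (level (vertex i))              ≡⟨ cong (mod3 ∘ level) start≡end ⟩
      mod3 (level (T.last-vertex j))       ∎)
      where
      open ≡-Reasoning
      start≡end : vertex i ≡ T.last-vertex j
      start≡end = ∷-injectiveˡ (trans reversed (reverse-++ (vertex j ∷ T.inner j) [ T.last-vertex j ]))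

    private-edge : ∀ i → ∃[ x ] ∃[ y ] PathEdge (family i) x y × (∀ j → j ≢ i → ¬ PathEdge (family j) x y)
    private-edge i = v , parent v , inj₁ (subst (Consec v (parent v)) (sym (T.vertices≡ i)) now) , not-in
      where
      v : Fin n
      v = vertex i
      along : ∀ j {a b} → Consec a b (tverts (family j)) →
              ∃[ t ] suc t < suc (suc (T.s j)) × a ≡ ancestor (vertex j) t × b ≡ ancestor (vertex j) (suc t)
      along j ab = consec-applyUpTo (ancestor (vertex j)) (suc (suc (T.s j))) (subst (Consec _ _) (T.vertices≡ j) ab)
      not-in : ∀ j → j ≢ i → ¬ PathEdge (family j) v (parent v)
      not-in j j≢i (inj₁ forward) with along j forward
      ... | zero  , _  , v≡w , _ = j≢i (enumerate-injective (inClass c) (sym v≡w))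
      ... | suc t , t< , v≡a , _ =
        true≢false (trans (sym (vertex-N i)) (trans (cong N? v≡a) (T.inner-not-N j (s≤s⁻¹ (s≤s⁻¹ t<)))))
      not-in j j≢i (inj₂ backward) with along j backward
      ... | t , t< , pv≡a , v≡pa = grandparent≢ (T.v∉Z i) (vertex-pos i) pv-pos
        (trans (cong parent pv≡a) (trans (sym (ancestor-suc t (vertex j))) (sym v≡pa)))
        where
        pv-pos : 0 < depth (parent v)
        pv-pos = subst (λ z → 0 < depth z) (sym pv≡a) (ancestor-pos t (T.v∉Z j) (≤-trans (s≤s⁻¹ t<) (T.s<depth j)))

    normal : Normal family
    normal = anticomplete-or-common-end , private-edge

  level≥2 : ∀ {v} → N? v ≡ true → 0 < depth v → 2 ≤ level v
  level≥2 {v} v∈N pos = subst (2 ≤_) (sym (trans (level-parent v∉Z pos) (cong (λ b → ind b + level (parent v)) v∈N)))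
    (s≤s (level-positive (parent-InF v∉Z pos)))
    where v∉Z = N?⇒InF v∈N

  level-rootOf : ∀ {x} → InF x → level (rootOf x) ≡ 1
  level-rootOf {x} x∉Z = begin
    level (rootOf x)                    ≡⟨ cong (λ d → levelAt d (rootOf x)) root-depth ⟩
    ind (N? (rootOf x))                 ≡⟨ cong ind (proj₁ (∧-true⁻ (N? (rootOf x)) (rootOf-isRoot x∉Z))) ⟩
    1                                   ∎
    where
    open ≡-Reasoning
    root-depth : depth (rootOf x) ≡ 0
    root-depth = trans (ancestor-depth (depth x) x∉Z ≤-refl) (n∸n≡0 (depth x))

  -- The last vertex of N above v before its root has level 2.
  level-two-ancestor : ∀ {v} → N? v ≡ true → 0 < depth v →
    ∃[ i ] i < depth v × N? (ancestor v i) ≡ true × level (ancestor v i) ≡ 2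
  level-two-ancestor {v} v∈N pos = i , i<depth , a∈N , level-a≡2
    where
    open TransitionFrom v∈N pos using (v∉Z; K; depth≡)
    atRootLevel : ℕ → Bool
    atRootLevel j = level (ancestor v (suc j)) ≡ᵇ 1
    root-level : atRootLevel K ≡ true
    root-level = Equivalence.to T-≡ (≡⇒≡ᵇ _ 1
      (trans (cong (λ d → level (ancestor v d)) (sym depth≡)) (level-rootOf v∉Z)))
    i : ℕ
    i = least atRootLevel K
    i<depth : i < depth v
    i<depth = subst (i <_) (sym depth≡) (s≤s (least-≤ atRootLevel K))
    a : Fin n
    a = ancestor v i
    parent-level : level (parent a) ≡ 1
    parent-level = trans (cong level (sym (ancestor-suc i v)))
                         (≡ᵇ⇒≡ _ 1 (Equivalence.from T-≡ (least-holds atRootLevel K root-level ≤-refl)))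
    a-level : level a ≡ ind (N? a) + 1
    a-level = trans (level-parent (ancestor-InF i v∉Z (<⇒≤ i<depth)) (ancestor-pos i v∉Z i<depth))
                    (cong (ind (N? a) +_) parent-level)
    below-root : ∀ j → j ≤ i → 2 ≤ level (ancestor v j)
    below-root zero    _  = level≥2 v∈N pos
    below-root (suc j) j< = ≤∧≢⇒< (level-positive (ancestor-InF (suc j) v∉Z j≤depth)) 1≢level
      where
      j≤depth : suc j ≤ depth v
      j≤depth = ≤-trans j< (<⇒≤ i<depth)
      1≢level : 1 ≢ level (ancestor v (suc j))
      1≢level e = true≢false (trans (sym (Equivalence.to T-≡ (≡⇒≡ᵇ _ 1 (sym e))))
                                    (least-below atRootLevel K j j<))
    a∈N : N? a ≡ true
    a∈N with N? a in eq
    ... | true  = refl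
    ... | false = ⊥-elim (1+n≰n (subst (2 ≤_) (trans a-level (cong (λ b → ind b + 1) eq)) (below-root i ≤-refl)))
    level-a≡2 : level a ≡ 2
    level-a≡2 = trans a-level (cong (λ b → ind b + 1) a∈N)

  rootN-depth : ∀ {r} → rootN r ≡ true → depth r ≡ 0
  rootN-depth {r} r-root = <ᵇ-false⇒≡0 (depth r) (not-true⇒false (proj₂ (∧-true⁻ (N? r) r-root)))

  other-N-vertex : ∀ {r} → InF r → ∃[ v ] N? v ≡ true × v ≢ r × ReachF G Z r v
  other-N-vertex {r} r∉Z with two r r∉Z
  ... | u , w , u≢w , u∈N , w∈N , ru , rw with u ≟ᶠ r
  ... | yes u≡r = w , ∈N⇒N? w∈N , (λ w≡r → u≢w (trans u≡r (sym w≡r))) , rw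
  ... | no  u≢r = u , ∈N⇒N? u∈N , u≢r , ru

  root-below-class-two : ∀ {r} → rootN r ≡ true → ∃[ a ] inClass (# 2) a ≡ true × rootOf a ≡ r
  root-below-class-two {r} r-root with other-N-vertex (N?⇒InF (proj₁ (∧-true⁻ (N? r) r-root)))
  ... | v , v∈N , v≢r , rv = level-two-vertex (level-two-ancestor v∈N v-pos)
    where
    v∉Z = reach-target rv
    rootOf-v : rootOf v ≡ r
    rootOf-v = trans (sym (rootOf-cong rv)) (cong (ancestor r) (rootN-depth r-root))
    v-pos : 0 < depth v
    v-pos = n≢0⇒n>0 λ d0 → v≢r (trans (sym (cong (ancestor v) d0)) rootOf-v)
    level-two-vertex : ∃[ i ] i < depth v × N? (ancestor v i) ≡ true × level (ancestor v i) ≡ 2 →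
                       ∃[ a ] inClass (# 2) a ≡ true × rootOf a ≡ r
    level-two-vertex (i , i<depth , a∈N , level≡2) =
      ancestor v i , ∧-true⁺ (∧-true⁺ a∈N a-positive) a-residue , rootOf-a
      where
      a-positive : positive? (ancestor v i) ≡ true
      a-positive = Equivalence.to T-≡ (<⇒<ᵇ (ancestor-pos i v∉Z i<depth))
      a-residue : (residue (ancestor v i) == # 2) ≡ true
      a-residue = subst (λ L → (mod3 L == # 2) ≡ true) (sym level≡2) (==-refl {3} (# 2))
      rootOf-a : rootOf (ancestor v i) ≡ r
      rootOf-a = trans (sym (rootOf-cong (ancestor-reach i v∉Z (<⇒≤ i<depth)))) rootOf-v

  roots≤class-two : count rootN ≤ Class.size (# 2)
  roots≤class-two = count-≤-retract pick rootOf (λ r e → proj₁ (pick-spec e)) (λ r e → proj₂ (pick-spec e))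
    where
    below : Fin n → Fin n → Bool
    below r a = inClass (# 2) a ∧ (rootOf a == r)
    pick : Fin n → Fin n
    pick r = firstOr r (below r)
    pick-spec : ∀ {r} → rootN r ≡ true → inClass (# 2) (pick r) ≡ true × rootOf (pick r) ≡ r
    pick-spec {r} r-root = chosen (root-below-class-two r-root)
      where
      chosen : ∃[ a ] inClass (# 2) a ≡ true × rootOf a ≡ r →
               inClass (# 2) (pick r) ≡ true × rootOf (pick r) ≡ r
      chosen (a , a∈2 , a↦r) = proj₁ picked , ==⇒≡ (proj₂ picked)
        where
        picked : inClass (# 2) (pick r) ≡ true × (rootOf (pick r) == r) ≡ true
        picked = ∧-true⁻ (inClass (# 2) (pick r))
          (firstOr-holds (below r) a (∧-true⁺ a∈2 (subst (λ z → (z == r) ≡ true) (sym a↦r) (==-refl r))))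

  ∣N∣≡ : ∣ Nset G Z ∣ ≡ Class.size (# 0) + Class.size (# 1) + Class.size (# 2) + count rootN
  ∣N∣≡ = begin
    ∣ Nset G Z ∣                    ≡⟨ ∣p∣≡count (Nset G Z) ⟩
    count N?                        ≡⟨ count-split N? positive? ⟩
    count nonRootN + count rootN    ≡⟨ cong (_+ count rootN) (count-by-residue nonRootN residue) ⟩
    Class.size (# 0) + Class.size (# 1) + Class.size (# 2) + count rootN ∎
    where open ≡-Reasoning

  ∣N∣≤4*largest : ∃[ c ] ∣ Nset G Z ∣ ≤ 4 * Class.size c
  ∣N∣≤4*largest with largest Class.size
  ... | c , max = c , (begin
    ∣ Nset G Z ∣                                                                       ≡⟨ ∣N∣≡ ⟩
    Class.size (# 0) + Class.size (# 1) + Class.size (# 2) + count rootN ≤⟨ bound ⟩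
    Class.size c + Class.size c + Class.size c + Class.size c                           ≡⟨ four-times (Class.size c) ⟩
    4 * Class.size c                                                                    ∎)
    where
    open ≤-Reasoning
    bound : Class.size (# 0) + Class.size (# 1) + Class.size (# 2) + count rootN
            ≤ Class.size c + Class.size c + Class.size c + Class.size c
    bound = +-mono-≤ (+-mono-≤ (+-mono-≤ (max (# 0)) (max (# 1))) (max (# 2)))
                     (≤-trans roots≤class-two (max (# 2)))

mainTheorem11 : (s : ℕ) → 1 ≤ s → {n : ℕ} (G : Graph n) (Z : Subset n) →
    SOFree G s → CycleHitting G Z → ComponentsTwoN G Z →
    ∃[ k ] Σ (Fin k → Transition G Z) (λ S →
      Distinct S × Normal S × ∣ Nset G Z ∣ ≤ 4 * k)
mainTheorem11 _ _ G Z _ hit two =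
  size , family , distinct , normal , proj₂ (Construction.∣N∣≤4*largest G Z two hit)
  where open Construction.Class G Z two hit (proj₁ (Construction.∣N∣≤4*largest G Z two hit))
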